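{- Assume the setting described in the context. Let $H\subseteq G$ be a subgraph with $H-X$ series-parallel, let $\mathcal E$ be a NED of $H-X$, and let $F_1,\dots,F_\ell$ be $x$-ears of $\mathcal E$ that are nested in an ear $E$ of $\mathcal E$ such that the nest intervals $I(F_1),\dots,I(F_\ell)$ are pairwise edge-disjoint. Let $P$ be the minimal subpath of $E$ containing $\bigcup_{i=1}^\ell I(F_i)$. Then $\bigcup_{i=1}^\ell\overline{F_i}\cup P$ contains $\lfloor \ell/3\rfloor$ pairwise edge-disjoint subdivisions of $K_4$.
   Context: All graphs are finite, simple, undirected. Setting: $G$ is a graph with a vertex $x$; $X=N(x)\cup\{x\}$; every vertex of $X\setminus\{x\}$ has degree $2$ in $G$; $G-X$ is $2$-connected and series-parallel; and $G$ contains a subdivision of $K_4$. $N(X)$ is the set of vertices outside $X$ with a neighbour in $X$. An ear decomposition of a graph $J$ is a sequence $E_1,\dots,E_n$ of non-trivial paths with $J=\bigcup_i E_i$ and each $E_i$ ($i\ge 2$) meeting $\bigcup_{j<i}E_j$ exactly in its two endvertices. If $i<j$, both endvertices of $E_j$ lie on $E_i$, and no earlier ear contains both, then $E_j$ is nested in $E_i$, with nest interval $I(E_j)$ the subpath of $E_i$ between these endvertices. A NED (nested ear decomposition) is an ear decomposition in which every $E_j$, $j\ge 2$, is nested in some earlier ear and nest intervals of ears nested in a common ear are edge-disjoint or one contains the other. An ear is an $x$-ear if it contains a vertex of $N(X)$ in its interior. For an ear $F$ with endvertices $u,v$, $\overline F$ is the union of $F$ with all paths of length $2$ in $G$ from a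 vertex of $F-\{u,v\}$ to $x$. -}

module Defs where

open import Data.Nat as ℕ using (ℕ; zero; suc)
open import Data.Fin as Fin using (Fin; toℕ)
open import Data.Fin.Patterns using (0F; 1F; 2F; 3F; 4F; 5F)
open import Data.List using (List; []; _∷_; _++_)
open import Data.List.Membership.Propositional using (_∈_)
open import Data.List.Relation.Unary.All using (All)
open import Data.List.Relation.Unary.Unique.Propositional using (Unique)
open import Data.List.Relation.Unary.Linked using (Linked)
open import Data.Product using (Σ; ∃; ∃₂; _×_; _,_; proj₁; proj₂)
open import Data.Sum using (_⊎_)
open import Data.Unit using (⊤)
open import Relation.Nullary using (¬_)
open import Relation.Binary.PropositionalEquality using (_≡_; _≢_)

record Graph (n : ℕ) : Set₁ where
  field
    Adj        : Fin n → Fin n → Set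
    Adj-sym    : ∀ {u v} → Adj u v → Adj v u
    Adj-irrefl : ∀ {u} → ¬ Adj u u
open Graph public

record SubG (n : ℕ) : Set₁ where
  field
    V : Fin n → Set
    E : Fin n → Fin n → Set
open SubG public

data Consec {A : Set} : List A → A → A → Set where
  here  : ∀ {x y xs} → Consec (x ∷ y ∷ xs) x y
  there : ∀ {x xs a b} → Consec xs a b → Consec (x ∷ xs) a b

EdgeOf : {A : Set} → List A → A → A → Set
EdgeOf xs u v = Consec xs u v ⊎ Consec xs v u

Segment : {A : Set} → List A → List A → Set
Segment ys xs = ∃₂ λ as bs → xs ≡ as ++ ys ++ bs

StartsAt : {A : Set} → List A → A → Set
StartsAt xs u = ∃ λ r → xs ≡ u ∷ r

EndsAt : {A : Set} → List A → A → Set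
EndsAt xs v = ∃ λ r → xs ≡ r ++ v ∷ []

Contained : {A : Set} → List A → List A → Set
Contained xs ys = (∀ w → w ∈ xs → w ∈ ys) × (∀ u v → EdgeOf xs u v → EdgeOf ys u v)

EdgeDisjoint : {A : Set} → List A → List A → Set
EdgeDisjoint xs ys = ∀ u v → EdgeOf xs u v → ¬ EdgeOf ys u v

record NPath (n : ℕ) : Set where
  constructor npath
  field
    start : Fin n
    inner : List (Fin n)
    end   : Fin n
  verts : List (Fin n)
  verts = start ∷ inner ++ end ∷ []
open NPath public

module _ {n : ℕ} where

  whole : Graph n → SubG n
  whole G = record { V = λ _ → ⊤ ; E = Adj G }

  restrict : SubG n → (Fin n → Set) → SubG n
  restrict S W = record { V = λ v → V S v × W v
                        ; E = λ u v → E S u v × W u × W v }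

  IsSubgraph : Graph n → SubG n → Set
  IsSubgraph G H = (∀ u v → E H u v → Adj G u v)
                 × (∀ u v → E H u v → E H v u)
                 × (∀ u v → E H u v → V H u × V H v)

  IsPath : SubG n → List (Fin n) → Set
  IsPath S p = Unique p × Linked (E S) p × All (V S) p

  PathIn : SubG n → Fin n → Fin n → Set
  PathIn S u v = ∃ λ p → IsPath S p × StartsAt p u × EndsAt p v

  Connected : SubG n → Set
  Connected S = ∀ u v → V S u → V S v → PathIn S u v

  TwoConnected : SubG n → Set
  TwoConnected S =
    (∃ λ a → ∃ λ b → ∃ λ c → V S a × V S b × V S c × a ≢ b × a ≢ c × b ≢ c)
    × Connected S
    × (∀ w → Connected (restrict S (λ v → v ≢ w)))

  pairs : Fin 6 → Fin 4 × Fin 4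
  pairs 0F = 0F , 1F
  pairs 1F = 0F , 2F
  pairs 2F = 0F , 3F
  pairs 3F = 1F , 2F
  pairs 4F = 1F , 3F
  pairs 5F = 2F , 3F

  record K4Subdivision (S : SubG n) : Set where
    field
      branch     : Fin 4 → Fin n
      branch-inj : ∀ i j → branch i ≡ branch j → i ≡ j
      path       : Fin 6 → NPath n
      path-start : ∀ k → start (path k) ≡ branch (proj₁ (pairs k))
      path-end   : ∀ k → end (path k) ≡ branch (proj₂ (pairs k))
      path-in    : ∀ k → IsPath S (verts (path k))
      int-disj   : ∀ k k' w → k ≢ k' → w ∈ inner (path k) → ¬ (w ∈ verts (path k'))
    KEdge : Fin n → Fin n → Set
    KEdge u v = ∃ λ k → EdgeOf (verts (path k)) u v
  open K4Subdivision public

  K4EdgeDisjoint : {S : SubG n} → K4Subdivision S → K4Subdivision S → Set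
  K4EdgeDisjoint K K' = ∀ u v → KEdge K u v → ¬ KEdge K' u v

  record K4Minor (S : SubG n) : Set₁ where
    field
      B        : Fin 4 → Fin n → Set
      nonempty : ∀ i → ∃ (B i)
      B-in     : ∀ i v → B i v → V S v
      B-disj   : ∀ i j v → i ≢ j → B i v → ¬ B j v
      B-conn   : ∀ i → Connected (restrict S (B i))
      B-adj    : ∀ i j → i ≢ j → ∃₂ λ u v → B i u × B j v × E S u v

  SeriesParallel : SubG n → Set₁
  SeriesParallel S = ¬ K4Minor S

  InX : Graph n → Fin n → Fin n → Set
  InX G x v = v ≡ x ⊎ Adj G x v

  InNX : Graph n → Fin n → Fin n → Set
  InNX G x v = ¬ InX G x v × ∃ λ y → InX G x y × Adj G v y

  minusX : Graph n → Fin n → SubG n → SubG n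
  minusX G x S = restrict S (λ v → ¬ InX G x v)

  Degree2 : Graph n → Fin n → Set
  Degree2 G y = ∃₂ λ a b → a ≢ b × Adj G y a × Adj G y b
                × (∀ c → Adj G y c → c ≡ a ⊎ c ≡ b)

  -- Ear decompositions; ears are indexed by Fin k (index 0 = E_1)

  Earlier : ∀ {k} → (Fin k → NPath n) → Fin k → Fin n → Set
  Earlier Es j v = ∃ λ i → i Fin.< j × v ∈ verts (Es i)

  EarlierEdge : ∀ {k} → (Fin k → NPath n) → Fin k → Fin n → Fin n → Set
  EarlierEdge Es j u v = ∃ λ i → i Fin.< j × EdgeOf (verts (Es i)) u v

  record EarDecomposition (J : SubG n) {k : ℕ} (Es : Fin k → NPath n) : Set where
    field
      ear-path      : ∀ i → IsPath J (verts (Es i))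
      cover-V       : ∀ v → V J v → ∃ λ i → v ∈ verts (Es i)
      cover-E       : ∀ u v → E J u v → ∃ λ i → EdgeOf (verts (Es i)) u v
      attach-start  : ∀ j → 0 ℕ.< toℕ j → Earlier Es j (start (Es j))
      attach-end    : ∀ j → 0 ℕ.< toℕ j → Earlier Es j (end (Es j))
      attach-only   : ∀ j v → 0 ℕ.< toℕ j → v ∈ verts (Es j) → Earlier Es j v
                      → v ≡ start (Es j) ⊎ v ≡ end (Es j)
      attach-noedge : ∀ j u v → 0 ℕ.< toℕ j → EdgeOf (verts (Es j)) u v
                      → ¬ EarlierEdge Es j u v

  NestedIn : ∀ {k} → (Fin k → NPath n) → Fin k → Fin k → Set
  NestedIn Es j i = i Fin.< j
                  × start (Es j) ∈ verts (Es i) × end (Es j) ∈ verts (Es i)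
                  × (∀ i' → i' Fin.< i →
                       ¬ (start (Es j) ∈ verts (Es i') × end (Es j) ∈ verts (Es i')))

  Interval : ∀ {k} → (Fin k → NPath n) → Fin k → Fin k → List (Fin n) → Set
  Interval Es i j I = Segment I (verts (Es i))
                    × ((StartsAt I (start (Es j)) × EndsAt I (end (Es j)))
                       ⊎ (StartsAt I (end (Es j)) × EndsAt I (start (Es j))))

  NED : SubG n → ∀ {k} → (Fin k → NPath n) → Set
  NED J Es = EarDecomposition J Es
           × (∀ j → 0 ℕ.< toℕ j → ∃ λ i → NestedIn Es j i)
           × (∀ i j j' I I' → NestedIn Es j i → NestedIn Es j' i
               → Interval Es i j I → Interval Es i j' I'
               → EdgeDisjoint I I' ⊎ Contained I I' ⊎ Contained I' I)

  XEar : Graph n → Fin n → ∀ {k} → (Fin k → NPath n) → Fin k → Set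
  XEar G x Es j = ∃ λ w → w ∈ inner (Es j) × InNX G x w

  MinimalCover : ∀ {k ℓ} → (Fin k → NPath n) → Fin k → (Fin ℓ → Fin k) → List (Fin n) → Set
  MinimalCover Es e F P =
    Segment P (verts (Es e))
    × (∀ i I → Interval Es e (F i) I → Contained I P)
    × (∀ Q → Segment Q (verts (Es e))
         → (∀ i I → Interval Es e (F i) I → Contained I Q) → Contained P Q)

  BarEdge : Graph n → Fin n → NPath n → Fin n → Fin n → Set
  BarEdge G x F u v = ∃₂ λ w y → w ∈ inner F × w ≢ x × Adj G w y × Adj G y x
                    × ((u ≡ w × v ≡ y) ⊎ (u ≡ y × v ≡ w) ⊎ (u ≡ y × v ≡ x) ⊎ (u ≡ x × v ≡ y))

  UnionE : Graph n → Fin n → ∀ {k ℓ} → (Fin k → NPath n) → (Fin ℓ → Fin k)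
         → List (Fin n) → Fin n → Fin n → Set
  UnionE G x Es F P u v =
    (∃ λ i → EdgeOf (verts (Es (F i))) u v ⊎ BarEdge G x (Es (F i)) u v)
    ⊎ EdgeOf P u v

  UnionGraph : Graph n → Fin n → ∀ {k ℓ} → (Fin k → NPath n) → (Fin ℓ → Fin k)
             → List (Fin n) → SubG n
  UnionGraph G x Es F P = record { V = λ v → ∃ (UnionE G x Es F P v)
                                 ; E = UnionE G x Es F P }

-- Sort the x-ears F_i by the position of their nest interval on E and group them into consecutive
-- triples F₁, F₂, F₃. Each x-ear F_i has an inner vertex w_i with a spoke w_i – y_i – x, and since
-- y_i ∈ N(x) has degree 2, distinct ears have distinct y_i. For a triple take the branch vertices
-- x, w₂ and the ends a < b of I(F₂) on E: x reaches w₂ along its spoke, a via y₁, w₁, the half of F₁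
-- towards I(F₂) and E up to a, and b symmetrically via F₃ and E down to b; w₂ reaches a and b along
-- the two halves of F₂, and I(F₂) joins a to b. These six paths are internally disjoint, and the
-- K4s of different triples use disjoint stretches of E (the intervals are edge-disjoint and ordered),
-- different ears and different spokes.

module Submission where

open import Defs
open import Data.Nat using (ℕ; zero; suc; _+_; _∸_; _≤_; _<_; z≤n; s≤s)
open import Data.Nat.Properties
open import Data.Nat.DivMod using (_/_; m/n≡1+[m∸n]/n)
import Relation.Binary.Construct.On as On
open import Relation.Binary using (tri<; tri≈; tri>)
open import Data.List using (List; []; _∷_; _++_; [_]; length; take; drop; reverse; map; concatMap; allFin; lookup)
open import Data.List.Properties using (++-assoc; ++-identityʳ; length-++; take++drop≡id; unfold-reverse; reverse-++; length-tabulate)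
open import Data.List.Membership.Propositional using (_∈_; _∉_; find)
open import Data.List.Membership.Propositional.Properties using (∈-++⁻; ∈-++⁺ˡ; ∈-++⁺ʳ; ∈-∃++; ∈-map⁺; ∈-concatMap⁺; ∈-concatMap⁻; ∈-allFin; ∈-lookup)
open import Data.List.Relation.Unary.Any as Any using (here; there)
open import Data.List.Relation.Unary.All as All using (All; []; _∷_)
import Data.List.Relation.Unary.All.Properties as All
open import Data.List.Relation.Unary.AllPairs using (AllPairs; []; _∷_)
open import Data.List.Relation.Unary.Unique.Propositional using (Unique)
import Data.List.Relation.Unary.Unique.Propositional.Properties as Unique
open import Data.List.Relation.Unary.Linked as Linked using (Linked; []; [-]; _∷_)
open import Data.List.Relation.Unary.Linked.Properties using (Linked⇒AllPairs)
open import Data.List.Relation.Binary.Permutation.Propositional as ↭ using (_↭_; ↭-refl; ↭-sym; ↭⇒↭ₛ)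
import Data.List.Relation.Binary.Permutation.Propositional.Properties as ↭
import Data.List.Relation.Binary.Permutation.Setoid.Properties as ↭ₛ
open import Data.Product using (Σ; ∃; ∃₂; _×_; _,_; proj₁; proj₂)
open import Data.Sum as Sum using (_⊎_; inj₁; inj₂; [_,_]′; swap)
open import Data.Sum.Properties using (inj₁-injective; inj₂-injective)
open import Data.Fin as Fin using (Fin)
import Data.Fin.Properties as Fin
open import Data.Fin.Patterns using (0F; 1F; 2F; 3F; 4F; 5F)
open import Data.Empty using (⊥; ⊥-elim)
open import Function using (_∘_; id; case_of_)
open import Relation.Nullary using (¬_; yes; no)
open import Relation.Binary.PropositionalEquality
  using (_≡_; _≢_; refl; sym; trans; cong; cong₂; subst; subst₂; setoid; module ≡-Reasoning)

module _ {A : Set} where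

  unique-++⁻ˡ : ∀ {xs ys : List A} → Unique (xs ++ ys) → Unique xs
  unique-++⁻ˡ {[]} _ = []
  unique-++⁻ˡ {x ∷ xs} (x∉ ∷ u) = All.++⁻ˡ xs x∉ ∷ unique-++⁻ˡ u

  unique-++⁻ʳ : ∀ (xs : List A) {ys} → Unique (xs ++ ys) → Unique ys
  unique-++⁻ʳ [] u = u
  unique-++⁻ʳ (_ ∷ xs) (_ ∷ u) = unique-++⁻ʳ xs u

  unique-++⇒disjoint : ∀ (xs : List A) {ys v} → Unique (xs ++ ys) → v ∈ xs → v ∉ ys
  unique-++⇒disjoint (x ∷ xs) (x∉ ∷ _) (here refl) v∈ys = All.lookup (All.++⁻ʳ xs x∉) v∈ys refl
  unique-++⇒disjoint (x ∷ xs) (_ ∷ u) (there v∈xs) = unique-++⇒disjoint xs u v∈xs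

  ∈-path : ∀ {a b v : A} xs → v ∈ a ∷ xs ++ [ b ] → v ≡ a ⊎ v ∈ xs ⊎ v ≡ b
  ∈-path xs (here refl) = inj₁ refl
  ∈-path xs (there v∈) with ∈-++⁻ xs v∈
  ... | inj₁ v∈xs = inj₂ (inj₁ v∈xs)
  ... | inj₂ (here refl) = inj₂ (inj₂ refl)

  consec-++ˡ : ∀ {xs : List A} ys {u v} → Consec xs u v → Consec (xs ++ ys) u v
  consec-++ˡ ys here = here
  consec-++ˡ ys (there c) = there (consec-++ˡ ys c)

  consec-++ʳ : ∀ xs {ys : List A} {u v} → Consec ys u v → Consec (xs ++ ys) u v
  consec-++ʳ [] c = c
  consec-++ʳ (_ ∷ xs) c = there (consec-++ʳ xs c)

  consec-∈ : ∀ {xs : List A} {u v} → Consec xs u v → u ∈ xs × v ∈ xs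
  consec-∈ here = here refl , there (here refl)
  consec-∈ (there c) = there (proj₁ (consec-∈ c)) , there (proj₂ (consec-∈ c))

  edgeOf-∈ : ∀ {xs : List A} {u v} → EdgeOf xs u v → u ∈ xs × v ∈ xs
  edgeOf-∈ (inj₁ c) = consec-∈ c
  edgeOf-∈ (inj₂ c) = proj₂ (consec-∈ c) , proj₁ (consec-∈ c)

  linked-consec : ∀ {R : A → A → Set} xs → (∀ {u v} → Consec xs u v → R u v) → Linked R xs
  linked-consec [] _ = []
  linked-consec (_ ∷ []) _ = [-]
  linked-consec (_ ∷ y ∷ xs) r = r here ∷ linked-consec (y ∷ xs) (r ∘ there)

  consec-linked : ∀ {R : A → A → Set} {xs u v} → Linked R xs → Consec xs u v → R u v
  consec-linked (r ∷ _) here = r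
  consec-linked (_ ∷ l) (there c) = consec-linked l c

  glue : ∀ {R : A → A → Set} xs {c ys} → Linked R (xs ++ [ c ]) → Linked R (c ∷ ys) → Linked R (xs ++ c ∷ ys)
  glue [] _ l = l
  glue (_ ∷ []) (r ∷ [-]) l = r ∷ l
  glue (_ ∷ y ∷ xs) (r ∷ l′) l = r ∷ glue (y ∷ xs) l′ l

  attach : ∀ {R : A → A → Set} xs {c ys zs} → c ∷ ys ≡ zs → Linked R (xs ++ [ c ]) → Linked R zs → Linked R (xs ++ zs)
  attach xs refl = glue xs

  linked-reverse : ∀ {R : A → A → Set} → (∀ {u v} → R u v → R v u) → ∀ {xs} → Linked R xs → Linked R (reverse xs)
  linked-reverse R-sym [] = []
  linked-reverse R-sym [-] = [-]
  linked-reverse {R} R-sym {x ∷ y ∷ ys} (r ∷ l) =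
    subst (Linked R) (sym reversed) (glue (reverse ys) (subst (Linked R) (unfold-reverse y ys) (linked-reverse R-sym l)) (R-sym r ∷ [-]))
    where
      reversed : reverse (x ∷ y ∷ ys) ≡ reverse ys ++ y ∷ x ∷ []
      reversed = begin
        reverse (x ∷ y ∷ ys)          ≡⟨ unfold-reverse x (y ∷ ys) ⟩
        reverse (y ∷ ys) ++ [ x ]     ≡⟨ cong (_++ [ x ]) (unfold-reverse y ys) ⟩
        (reverse ys ++ [ y ]) ++ [ x ] ≡⟨ ++-assoc (reverse ys) [ y ] [ x ] ⟩
        reverse ys ++ y ∷ x ∷ []      ∎
        where open ≡-Reasoning

  linked-All : ∀ {R : A → A → Set} {P : A → Set} → (∀ {u v} → R u v → P u) → (∀ {u v} → R u v → P v)
             → ∀ {a c} xs → Linked R (a ∷ xs ++ [ c ]) → All P (a ∷ xs ++ [ c ])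
  linked-All Pˡ Pʳ [] (r ∷ [-]) = Pˡ r ∷ Pʳ r ∷ []
  linked-All Pˡ Pʳ (_ ∷ xs) (r ∷ l) = Pˡ r ∷ linked-All Pˡ Pʳ xs l

  no-three-in-pair : ∀ {a b u v w : A} → (u ≡ a ⊎ u ≡ b) → (v ≡ a ⊎ v ≡ b) → (w ≡ a ⊎ w ≡ b)
                   → u ≢ v → u ≢ w → v ≢ w → ⊥
  no-three-in-pair (inj₁ refl) (inj₁ refl) _ u≢v _ _ = u≢v refl
  no-three-in-pair (inj₂ refl) (inj₂ refl) _ u≢v _ _ = u≢v refl
  no-three-in-pair (inj₁ refl) (inj₂ refl) (inj₁ refl) _ u≢w _ = u≢w refl
  no-three-in-pair (inj₁ refl) (inj₂ refl) (inj₂ refl) _ _ v≢w = v≢w refl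
  no-three-in-pair (inj₂ refl) (inj₁ refl) (inj₁ refl) _ _ v≢w = v≢w refl
  no-three-in-pair (inj₂ refl) (inj₁ refl) (inj₂ refl) _ u≢w _ = u≢w refl

  unique-++-separated : ∀ {Q : A → Set} {xs ys} → Unique xs → Unique ys
                      → (∀ {v} → v ∈ xs → Q v) → (∀ {v} → v ∈ ys → ¬ Q v) → Unique (xs ++ ys)
  unique-++-separated Uxs Uys Qxs ¬Qys = Unique.++⁺ Uxs Uys (λ (v∈xs , v∈ys) → ¬Qys v∈ys (Qxs v∈xs))

  unique-resp-↭ : ∀ {xs ys : List A} → xs ↭ ys → Unique xs → Unique ys
  unique-resp-↭ p = ↭ₛ.Unique-resp-↭ (setoid A) (↭⇒↭ₛ p)

  linked-prefix : ∀ xs ys → Linked (EdgeOf (xs ++ ys)) xs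
  linked-prefix xs ys = linked-consec xs (inj₁ ∘ consec-++ˡ ys)

  linked-suffix : ∀ xs ys → Linked (EdgeOf (xs ++ ys)) ys
  linked-suffix xs ys = linked-consec ys (inj₁ ∘ consec-++ʳ xs)

module _ {A : Set} where

  nth : List A → A → ℕ → A
  nth [] d _ = d
  nth (a ∷ _) _ zero = a
  nth (_ ∷ xs) d (suc t) = nth xs d t

  nth-∈ : ∀ {xs d t} → t < length xs → nth xs d t ∈ xs
  nth-∈ {_ ∷ _} {t = zero} _ = here refl
  nth-∈ {_ ∷ _} {t = suc t} (s≤s t<) = there (nth-∈ t<)

  ∈⇒nth : ∀ {xs d v} → v ∈ xs → ∃ λ t → t < length xs × v ≡ nth xs d t
  ∈⇒nth (here refl) = zero , s≤s z≤n , refl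
  ∈⇒nth (there v∈) with ∈⇒nth v∈
  ... | t , t< , eq = suc t , s≤s t< , eq

  nth-injective : ∀ {xs d t t′} → Unique xs → t < length xs → t′ < length xs → nth xs d t ≡ nth xs d t′ → t ≡ t′
  nth-injective {t = zero} {zero} _ _ _ _ = refl
  nth-injective {t = zero} {suc t′} (a∉ ∷ _) _ (s≤s t′<) eq = ⊥-elim (All.lookup a∉ (nth-∈ t′<) eq)
  nth-injective {t = suc t} {zero} (a∉ ∷ _) (s≤s t<) _ eq = ⊥-elim (All.lookup a∉ (nth-∈ t<) (sym eq))
  nth-injective {t = suc t} {suc t′} (_ ∷ u) (s≤s t<) (s≤s t′<) eq = cong suc (nth-injective u t< t′< eq)

  take-suc : ∀ {xs d} p → p < length xs → take (suc p) xs ≡ take p xs ++ [ nth xs d p ]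
  take-suc {_ ∷ _} zero _ = refl
  take-suc {x ∷ xs} (suc p) (s≤s p<) = cong (x ∷_) (take-suc {xs} p p<)

  nth-++ : ∀ xs {ys d} → nth (xs ++ ys) d (length xs) ≡ nth ys d 0
  nth-++ [] = refl
  nth-++ (_ ∷ xs) = nth-++ xs

n∸m+o∸n≡o∸m : ∀ {a b c} → a ≤ b → b ≤ c → (b ∸ a) + (c ∸ b) ≡ c ∸ a
n∸m+o∸n≡o∸m {a} {b} {c} a≤b b≤c = begin
  (b ∸ a) + (c ∸ b)             ≡⟨ sym (m+n∸m≡n a _) ⟩
  a + ((b ∸ a) + (c ∸ b)) ∸ a   ≡⟨ cong (_∸ a) (sym (+-assoc a (b ∸ a) (c ∸ b))) ⟩
  (a + (b ∸ a)) + (c ∸ b) ∸ a   ≡⟨ cong (λ z → z + (c ∸ b) ∸ a) (m+[n∸m]≡n a≤b) ⟩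
  b + (c ∸ b) ∸ a               ≡⟨ cong (_∸ a) (m+[n∸m]≡n b≤c) ⟩
  c ∸ a                         ∎
  where open ≡-Reasoning

-- Positions along a list

-- seg a b lists the entries of L at the positions a ≤ t < b; at returns the junk value d beyond the end of L.
module Positions {A : Set} (L : List A) (d : A) where

  at : ℕ → A
  at = nth L d

  slice : ℕ → ℕ → List A
  slice p zero = []
  slice p (suc k) = at p ∷ slice (suc p) k

  seg : ℕ → ℕ → List A
  seg a b = slice a (b ∸ a)

  slice-++ : ∀ p i j → slice p (i + j) ≡ slice p i ++ slice (p + i) j
  slice-++ p zero j = cong (λ q → slice q j) (sym (+-identityʳ p))
  slice-++ p (suc i) j = cong (at p ∷_) (trans (slice-++ (suc p) i j) (cong (λ q → slice (suc p) i ++ slice q j) (sym (+-suc p i))))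

  ∈-slice : ∀ {v} p k → v ∈ slice p k → ∃ λ t → p ≤ t × t < p + k × v ≡ at t
  ∈-slice p (suc k) (here refl) = p , ≤-refl , m<m+n p (s≤s z≤n) , refl
  ∈-slice p (suc k) (there v∈) with ∈-slice (suc p) k v∈
  ... | t , p< , t< , eq = t , <⇒≤ p< , subst (t <_) (sym (+-suc p k)) t< , eq

  consec-slice : ∀ k p t → p ≤ t → suc t < p + k → Consec (slice p k) (at t) (at (suc t))
  consec-slice zero p t p≤t t< = ⊥-elim (<-irrefl refl (<-trans (s≤s p≤t) (subst (suc t <_) (+-identityʳ p) t<)))
  consec-slice (suc zero) p t p≤t t< = ⊥-elim (<-irrefl refl (≤-<-trans (s≤s p≤t) (subst (suc t <_) (+-comm p 1) t<)))
  consec-slice (suc (suc k)) p t p≤t t< =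
    [ (λ p<t → there (consec-slice (suc k) (suc p) t p<t (subst (suc t <_) (+-suc p (suc k)) t<)))
    , (λ { refl → here }) ]′ (m≤n⇒m<n∨m≡n p≤t)

  slice-infix : ∀ p k → p + k ≤ length L → L ≡ take p L ++ slice p k ++ drop (p + k) L
  slice-infix p zero _ = trans (sym (take++drop≡id p L)) (cong (λ q → take p L ++ drop q L) (sym (+-identityʳ p)))
  slice-infix p (suc k) bound = begin
    L                                                          ≡⟨ slice-infix (suc p) k (subst (_≤ length L) (+-suc p k) bound) ⟩
    take (suc p) L ++ slice (suc p) k ++ drop (suc p + k) L    ≡⟨ cong (_++ slice (suc p) k ++ drop (suc p + k) L) (take-suc p (<-≤-trans (m<m+n p (s≤s z≤n)) bound)) ⟩
    (take p L ++ [ at p ]) ++ slice (suc p) k ++ drop (suc p + k) L ≡⟨ ++-assoc (take p L) [ at p ] _ ⟩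
    take p L ++ slice p (suc k) ++ drop (suc p + k) L          ≡⟨ cong (λ q → take p L ++ slice p (suc k) ++ drop q L) (sym (+-suc p k)) ⟩
    take p L ++ slice p (suc k) ++ drop (p + suc k) L          ∎
    where open ≡-Reasoning

  slice-infix⁻ : ∀ as P bs → L ≡ as ++ P ++ bs → slice (length as) (length P) ≡ P
  slice-infix⁻ as [] bs _ = refl
  slice-infix⁻ as (c ∷ P) bs L≡ = cong₂ _∷_ (trans (cong (λ xs → nth xs d (length as)) L≡) (nth-++ as))
    (subst (λ q → slice q (length P) ≡ P) (trans (length-++ as) (+-comm (length as) 1))
      (slice-infix⁻ (as ++ [ c ]) P bs (trans L≡ (sym (++-assoc as [ c ] (P ++ bs))))))

  seg-++ : ∀ {a b c} → a ≤ b → b ≤ c → seg a b ++ seg b c ≡ seg a c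
  seg-++ {a} {b} {c} a≤b b≤c = begin
    slice a (b ∸ a) ++ slice b (c ∸ b)             ≡⟨ cong (λ q → slice a (b ∸ a) ++ slice q (c ∸ b)) (sym (m+[n∸m]≡n a≤b)) ⟩
    slice a (b ∸ a) ++ slice (a + (b ∸ a)) (c ∸ b) ≡⟨ sym (slice-++ a (b ∸ a) (c ∸ b)) ⟩
    slice a ((b ∸ a) + (c ∸ b))                    ≡⟨ cong (slice a) (n∸m+o∸n≡o∸m a≤b b≤c) ⟩
    slice a (c ∸ a)                                ∎
    where open ≡-Reasoning

  seg-cons : ∀ {a b} → a < b → seg a b ≡ at a ∷ seg (suc a) b
  seg-cons a<b = cong (slice _) (+-∸-assoc 1 a<b)

  seg-snoc : ∀ {a b} → a ≤ b → seg a (suc b) ≡ seg a b ++ [ at b ]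
  seg-snoc {a} {b} a≤b = trans (sym (seg-++ a≤b (n≤1+n b))) (cong (λ k → seg a b ++ slice b k) (m+n∸n≡m 1 b))

  ∈-seg : ∀ {a b v} → a ≤ b → v ∈ seg a b → ∃ λ t → a ≤ t × t < b × v ≡ at t
  ∈-seg {a} {b} a≤b v∈ with ∈-slice a (b ∸ a) v∈
  ... | t , a≤t , t< , eq = t , a≤t , subst (t <_) (m+[n∸m]≡n a≤b) t< , eq

  consec-seg : ∀ {a b} t → a ≤ t → suc t < b → Consec (seg a b) (at t) (at (suc t))
  consec-seg {a} {b} t a≤t t< =
    consec-slice (b ∸ a) a t a≤t (subst (suc t <_) (sym (m+[n∸m]≡n (≤-trans a≤t (<⇒≤ (<-trans (n<1+n t) t<))))) t<)

  seg-infix : ∀ {a b} → a ≤ b → b ≤ length L → L ≡ take a L ++ seg a b ++ drop b L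
  seg-infix {a} {b} a≤b b≤ =
    subst (λ q → L ≡ take a L ++ seg a b ++ drop q L) (m+[n∸m]≡n a≤b) (slice-infix a (b ∸ a) (subst (_≤ length L) (sym (m+[n∸m]≡n a≤b)) b≤))

  seg-unique : ∀ {a b} → Unique L → a ≤ b → b ≤ length L → Unique (seg a b)
  seg-unique {a} U a≤b b≤ = unique-++⁻ˡ (unique-++⁻ʳ (take a L) (subst Unique (seg-infix a≤b b≤) U))

  consec-seg-mono : ∀ {a b c e u v} → a ≤ c → c ≤ e → e ≤ b → Consec (seg c e) u v → Consec (seg a b) u v
  consec-seg-mono {a} {b} {c} {e} {u} {v} a≤c c≤e e≤b cons =
    subst (λ xs → Consec xs u v) split (consec-++ʳ (seg a c) (consec-++ˡ (seg e b) cons))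
    where
      split : seg a c ++ seg c e ++ seg e b ≡ seg a b
      split = trans (cong (seg a c ++_) (seg-++ c≤e e≤b)) (seg-++ a≤c (≤-trans c≤e e≤b))

  infix⇒seg : ∀ as P bs → L ≡ as ++ P ++ bs → P ≡ seg (length as) (length as + length P)
  infix⇒seg as P bs L≡ = sym (trans (cong (slice (length as)) (m+n∸m≡n (length as) (length P))) (slice-infix⁻ as P bs L≡))

-- K4 subdivisions from internally disjoint paths

module _ {B A : Set} (part : B → List A) where

  ∈-concatMap : ∀ {bs i v} → i ∈ bs → v ∈ part i → v ∈ concatMap part bs
  ∈-concatMap i∈ v∈ = ∈-concatMap⁺ part (Any.map (λ { refl → v∈ }) i∈)

  unique-concatMap⇒same-part : ∀ {bs i j v} → Unique (concatMap part bs) → i ∈ bs → j ∈ bs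
                             → v ∈ part i → v ∈ part j → i ≡ j
  unique-concatMap⇒same-part _ (here refl) (here refl) _ _ = refl
  unique-concatMap⇒same-part {c ∷ _} U (here refl) (there j∈) v∈i v∈j =
    ⊥-elim (unique-++⇒disjoint (part c) U v∈i (∈-concatMap j∈ v∈j))
  unique-concatMap⇒same-part {c ∷ _} U (there i∈) (here refl) v∈i v∈j =
    ⊥-elim (unique-++⇒disjoint (part c) U v∈j (∈-concatMap i∈ v∈i))
  unique-concatMap⇒same-part {c ∷ _} U (there i∈) (there j∈) =
    unique-concatMap⇒same-part (unique-++⁻ʳ (part c) U) i∈ j∈

  unique-concatMap⇒unique-part : ∀ {bs i} → Unique (concatMap part bs) → i ∈ bs → Unique (part i)
  unique-concatMap⇒unique-part U (here refl) = unique-++⁻ˡ U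
  unique-concatMap⇒unique-part {c ∷ _} U (there i∈) = unique-concatMap⇒unique-part (unique-++⁻ʳ (part c) U) i∈

  unique-concatMap-⊆ : ∀ {bs cs} → Unique (concatMap part bs) → Unique cs → (∀ {c} → c ∈ cs → c ∈ bs)
                     → Unique (concatMap part cs)
  unique-concatMap-⊆ U [] _ = []
  unique-concatMap-⊆ {cs = c ∷ cs} U (c∉ ∷ Ucs) cs⊆bs =
    Unique.++⁺ (unique-concatMap⇒unique-part U (cs⊆bs (here refl))) (unique-concatMap-⊆ U Ucs (cs⊆bs ∘ there)) disjoint
    where
      disjoint : ∀ {v} → ¬ (v ∈ part c × v ∈ concatMap part cs)
      disjoint (v∈c , v∈cs) with find (∈-concatMap⁻ part v∈cs)
      ... | c′ , c′∈ , v∈c′ =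
        All.lookup c∉ c′∈ (unique-concatMap⇒same-part U (cs⊆bs (here refl)) (cs⊆bs (there c′∈)) v∈c v∈c′)

module _ {n : ℕ} {S : SubG n} {R : Fin n → Fin n → Set}
         (R-sym : ∀ {u v} → R u v → R v u) (R⇒E : ∀ {u v} → R u v → E S u v) (E⇒V : ∀ {u v} → E S u v → V S u) where

  k4-from-paths : (b : Fin 4 → Fin n) (I : Fin 6 → List (Fin n))
    → Unique (b 0F ∷ b 1F ∷ b 2F ∷ b 3F ∷ I 0F ++ I 1F ++ I 2F ++ I 3F ++ I 4F ++ I 5F)
    → (∀ k → Linked R (b (proj₁ (pairs {n} k)) ∷ I k ++ [ b (proj₂ (pairs {n} k)) ]))
    → Σ (K4Subdivision S) λ K → ∀ u v → KEdge K u v → R u v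
  k4-from-paths b I distinct linked = K , K-edges
    where
      part : Fin 4 ⊎ Fin 6 → List (Fin n)
      part (inj₁ i) = [ b i ]
      part (inj₂ k) = I k

      parts : List (Fin 4 ⊎ Fin 6)
      parts = map inj₁ (allFin 4) ++ map inj₂ (allFin 6)

      ∈-parts : ∀ p → p ∈ parts
      ∈-parts (inj₁ i) = ∈-++⁺ˡ (∈-map⁺ inj₁ (∈-allFin i))
      ∈-parts (inj₂ k) = ∈-++⁺ʳ (map inj₁ (allFin 4)) (∈-map⁺ inj₂ (∈-allFin k))

      unique-parts : Unique (concatMap part parts)
      unique-parts = subst Unique (cong (λ z → b 0F ∷ b 1F ∷ b 2F ∷ b 3F ∷ I 0F ++ I 1F ++ I 2F ++ I 3F ++ I 4F ++ z)
                                        (sym (++-identityʳ (I 5F)))) distinct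

      same-part : ∀ {p q v} → v ∈ part p → v ∈ part q → p ≡ q
      same-part = unique-concatMap⇒same-part part unique-parts (∈-parts _) (∈-parts _)

      src tgt : Fin 6 → Fin 4
      src k = proj₁ (pairs {n} k)
      tgt k = proj₂ (pairs {n} k)

      src≢tgt : ∀ k → src k ≢ tgt k
      src≢tgt 0F ()
      src≢tgt 1F ()
      src≢tgt 2F ()
      src≢tgt 3F ()
      src≢tgt 4F ()
      src≢tgt 5F ()

      route : Fin 6 → NPath n
      route k = npath (b (src k)) (I k) (b (tgt k))

      route-unique : ∀ k → Unique (verts (route k))
      route-unique k = unique-concatMap-⊆ part unique-parts
        (((λ ()) ∷ (src≢tgt k ∘ inj₁-injective) ∷ []) ∷ ((λ ()) ∷ []) ∷ [] ∷ []) (λ _ → ∈-parts _)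

      internally-disjoint : ∀ k k′ w → k ≢ k′ → w ∈ inner (route k) → w ∉ verts (route k′)
      internally-disjoint k k′ w k≢k′ w∈ w∈′ with ∈-path (I k′) w∈′
      ... | inj₁ refl = case (same-part {inj₂ k} {inj₁ (src k′)} w∈ (here refl)) of λ ()
      ... | inj₂ (inj₁ w∈I) = k≢k′ (inj₂-injective (same-part {inj₂ k} {inj₂ k′} w∈ w∈I))
      ... | inj₂ (inj₂ refl) = case (same-part {inj₂ k} {inj₁ (tgt k′)} w∈ (here refl)) of λ ()

      K : K4Subdivision S
      K = record
        { branch = b
        ; branch-inj = λ i j eq → inj₁-injective (same-part {inj₁ i} {inj₁ j} (here refl) (here eq))
        ; path = route
        ; path-start = λ _ → refl
        ; path-end = λ _ → refl
        ; path-in = λ k → route-unique k , Linked.map R⇒E (linked k)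
                        , linked-All (E⇒V ∘ R⇒E) (E⇒V ∘ R⇒E ∘ R-sym) (I k) (linked k)
        ; int-disj = internally-disjoint
        }

      K-edges : ∀ u v → KEdge K u v → R u v
      K-edges u v (k , inj₁ c) = consec-linked (linked k) c
      K-edges u v (k , inj₂ c) = R-sym (consec-linked (linked k) c)

module _ {n : ℕ} where

  split-at : ∀ (F : NPath n) {w} → w ∈ inner F
    → ∃₂ λ A B → inner F ↭ w ∷ A ++ B
               × Linked (EdgeOf (verts F)) (w ∷ A ++ [ start F ])
               × Linked (EdgeOf (verts F)) (w ∷ B ++ [ end F ])
  split-at (npath s I t) {w} w∈ with ∈-∃++ w∈
  ... | α , β , refl = reverse α , β , inner↭ , to-start , to-end
    where
      inner↭ : α ++ w ∷ β ↭ w ∷ reverse α ++ β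
      inner↭ = ↭.trans (↭.shift w α β) (↭.prep w (↭.++⁺ʳ β (↭-sym (↭.↭-reverse α))))

      verts≡ : s ∷ (α ++ w ∷ β) ++ [ t ] ≡ ((s ∷ α) ++ [ w ]) ++ β ++ [ t ]
      verts≡ = cong (s ∷_) (trans (++-assoc α (w ∷ β) [ t ]) (sym (++-assoc α [ w ] (β ++ [ t ]))))

      reverse≡ : reverse ((s ∷ α) ++ [ w ]) ≡ w ∷ reverse α ++ [ s ]
      reverse≡ = trans (reverse-++ (s ∷ α) [ w ]) (cong (w ∷_) (unfold-reverse s α))

      to-start : Linked (EdgeOf (s ∷ (α ++ w ∷ β) ++ [ t ])) (w ∷ reverse α ++ [ s ])
      to-start = subst₂ (λ V xs → Linked (EdgeOf V) xs) (sym verts≡) reverse≡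
                   (linked-reverse swap (linked-prefix ((s ∷ α) ++ [ w ]) (β ++ [ t ])))

      to-end : Linked (EdgeOf (s ∷ (α ++ w ∷ β) ++ [ t ])) (w ∷ β ++ [ t ])
      to-end = subst (λ V → Linked (EdgeOf V) (w ∷ β ++ [ t ])) (cong (s ∷_) (sym (++-assoc α (w ∷ β) [ t ])))
                 (linked-suffix (s ∷ α) (w ∷ β ++ [ t ]))

-- Grouping into ordered triples

module Triples {ℓ : ℕ} (key : Fin ℓ → ℕ) (key-injective : ∀ {i j} → key i ≡ key j → i ≡ j) where

  record Triple : Set where
    constructor triple
    field
      first second third : Fin ℓ
      first<second : key first < key second
      second<third : key second < key third

  open Triple public

  _≺_ : Triple → Triple → Set
  T ≺ T′ = key (third T) < key (first T′)

  private
    _<ᵏ_ : Fin ℓ → Fin ℓ → Set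
    i <ᵏ j = key i < key j

    open import Data.List.Sort (On.decTotalOrder ≤-decTotalOrder key) using (sort; sort-↭; sort-↗)

    sorted : List (Fin ℓ)
    sorted = sort (allFin ℓ)

    sorted-unique : Unique sorted
    sorted-unique = unique-resp-↭ (↭-sym (sort-↭ (allFin ℓ))) (Unique.allFin⁺ ℓ)

    strictly : ∀ {xs} → Linked (λ i j → key i ≤ key j) xs → Unique xs → Linked _<ᵏ_ xs
    strictly [] _ = []
    strictly [-] _ = [-]
    strictly (≤ᵏ ∷ l) ((i≢ ∷ _) ∷ u) = ≤∧≢⇒< ≤ᵏ (i≢ ∘ key-injective) ∷ strictly l u

    sorted-increasing : Linked _<ᵏ_ sorted
    sorted-increasing = strictly (sort-↗ (allFin ℓ)) sorted-unique

    chunk : (xs : List (Fin ℓ)) → Linked _<ᵏ_ xs → List Triple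
    chunk (a ∷ b ∷ c ∷ rest) (a<b ∷ b<c ∷ l) = triple a b c a<b b<c ∷ chunk rest (Linked.tail l)
    chunk _ _ = []

    length-chunk : ∀ xs l → length (chunk xs l) ≡ length xs / 3
    length-chunk [] _ = refl
    length-chunk (_ ∷ []) _ = refl
    length-chunk (_ ∷ _ ∷ []) _ = refl
    length-chunk (_ ∷ _ ∷ _ ∷ rest) (_ ∷ _ ∷ l) =
      trans (cong suc (length-chunk rest (Linked.tail l))) (sym (m/n≡1+[m∸n]/n {3 + length rest} {3} (s≤s (s≤s (s≤s z≤n)))))

    chunk-firsts : ∀ xs l → All (λ T → first T ∈ xs) (chunk xs l)
    chunk-firsts [] _ = []
    chunk-firsts (_ ∷ []) _ = []
    chunk-firsts (_ ∷ _ ∷ []) _ = []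
    chunk-firsts (_ ∷ _ ∷ _ ∷ rest) (_ ∷ _ ∷ l) = here refl ∷ All.map (λ p → there (there (there p))) (chunk-firsts rest (Linked.tail l))

    chunk-ordered : ∀ xs l → AllPairs _<ᵏ_ xs → AllPairs _≺_ (chunk xs l)
    chunk-ordered [] _ _ = []
    chunk-ordered (_ ∷ []) _ _ = []
    chunk-ordered (_ ∷ _ ∷ []) _ _ = []
    chunk-ordered (_ ∷ _ ∷ _ ∷ rest) (_ ∷ _ ∷ l) (_ ∷ _ ∷ (c< ∷ ap)) =
      All.map (All.lookup c<) (chunk-firsts rest (Linked.tail l)) ∷ chunk-ordered rest (Linked.tail l) ap

    ts : List Triple
    ts = chunk sorted sorted-increasing

    length-ts : length ts ≡ ℓ / 3
    length-ts = trans (length-chunk sorted sorted-increasing) (cong (_/ 3) length-sorted)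
      where
        length-sorted : length sorted ≡ ℓ
        length-sorted = trans (↭.↭-length (sort-↭ (allFin ℓ))) (length-tabulate id)

    lookup-ordered : ∀ {xs} → AllPairs _≺_ xs → ∀ i j → i ≢ j
                   → lookup xs i ≺ lookup xs j ⊎ lookup xs j ≺ lookup xs i
    lookup-ordered (_ ∷ _) Fin.zero Fin.zero i≢j = ⊥-elim (i≢j refl)
    lookup-ordered (T≺ ∷ _) Fin.zero (Fin.suc j) _ = inj₁ (All.lookup T≺ (∈-lookup j))
    lookup-ordered (T≺ ∷ _) (Fin.suc i) Fin.zero _ = inj₂ (All.lookup T≺ (∈-lookup i))
    lookup-ordered (_ ∷ ap) (Fin.suc i) (Fin.suc j) i≢j = lookup-ordered ap i j (i≢j ∘ cong Fin.suc)

  triples : Σ (Fin (ℓ / 3) → Triple) λ T → ∀ a b → a ≢ b → T a ≺ T b ⊎ T b ≺ T a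
  triples = lookup ts ∘ index , λ a b a≢b →
    lookup-ordered (chunk-ordered sorted sorted-increasing (Linked⇒AllPairs <-trans sorted-increasing))
                   (index a) (index b) (a≢b ∘ index-injective)
    where
      index : Fin (ℓ / 3) → Fin (length ts)
      index = Fin.cast (sym length-ts)

      index-injective : ∀ {a b} → index a ≡ index b → a ≡ b
      index-injective {a} {b} eq =
        Fin.toℕ-injective (trans (sym (Fin.toℕ-cast _ a)) (trans (cong Fin.toℕ eq) (Fin.toℕ-cast _ b)))

-- Nested x-ears

module NestedXEars {n : ℕ} (G : Graph n) (x : Fin n)
    (deg2 : ∀ y → Adj G x y → Degree2 G y)
    (H : SubG n) {k : ℕ} (Es : Fin k → NPath n) (ears : EarDecomposition (minusX G x H) Es)
    (e : Fin k) (ℓ : ℕ) (F : Fin ℓ → Fin k)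
    (x-ear : ∀ i → XEar G x Es (F i))
    (nested : ∀ i → NestedIn Es (F i) e)
    (intervals-disjoint : ∀ i i′ I I′ → i ≢ i′ → Interval Es e (F i) I → Interval Es e (F i′) I′ → EdgeDisjoint I I′)
    (P : List (Fin n)) (P-cover : MinimalCover Es e F P)
  where

  open EarDecomposition ears

  IsX : Fin n → Set
  IsX = InX G x

  ear-unique : ∀ j → Unique (verts (Es j))
  ear-unique j = proj₁ (ear-path j)

  ear-avoids-X : ∀ j {v} → v ∈ verts (Es j) → ¬ IsX v
  ear-avoids-X j v∈ = proj₂ (All.lookup (proj₂ (proj₂ (ear-path j))) v∈)

  inner⊆verts : ∀ {j v} → v ∈ inner (Es j) → v ∈ verts (Es j)
  inner⊆verts v∈ = there (∈-++⁺ˡ v∈)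

  inner-unique : ∀ j → Unique (inner (Es j))
  inner-unique j with ear-unique j
  ... | _ ∷ u = unique-++⁻ˡ u

  inner-not-earlier : ∀ {i j v} → i Fin.< j → v ∈ inner (Es j) → v ∉ verts (Es i)
  inner-not-earlier {i} {j} {v} i<j v∈ v∈i with attach-only j v (≤-trans (s≤s z≤n) i<j) (inner⊆verts v∈) (i , i<j , v∈i)
  ... | inj₁ refl = unique-++⇒disjoint [ start (Es j) ] (ear-unique j) (here refl) (∈-++⁺ˡ v∈)
  ... | inj₂ refl = unique-++⇒disjoint (inner (Es j)) (unique-++⁻ʳ [ start (Es j) ] (ear-unique j)) v∈ (here refl)

  edge-not-earlier : ∀ {i j u v} → i Fin.< j → EdgeOf (verts (Es j)) u v → ¬ EdgeOf (verts (Es i)) u v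
  edge-not-earlier {i} {j} {u} {v} i<j uv∈j uv∈i = attach-noedge j u v (≤-trans (s≤s z≤n) i<j) uv∈j (i , i<j , uv∈i)

  L : List (Fin n)
  L = verts (Es e)

  open Positions L x

  at-injective : ∀ {t t′} → t < length L → t′ < length L → at t ≡ at t′ → t ≡ t′
  at-injective = nth-injective (ear-unique e)

  E-avoids-X : ∀ {t} → t < length L → ¬ IsX (at t)
  E-avoids-X t< = ear-avoids-X e (nth-∈ t<)

  e<F : ∀ i → e Fin.< F i
  e<F i = proj₁ (nested i)

  inner-off-E : ∀ {i v} → v ∈ inner (Es (F i)) → v ∉ L
  inner-off-E {i} = inner-not-earlier (e<F i)

  record Ends (j : Fin k) : Set where
    field
      left right : ℕ
      left<right : left < right
      right<len : right < length L
      ends : (at left ≡ start (Es j) × at right ≡ end (Es j)) ⊎ (at left ≡ end (Es j) × at right ≡ start (Es j))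

  -- Abstract, so that the positions are only ever used through the fields of Ends.
  abstract
    ends-on-E : ∀ {j} → start (Es j) ∈ L → end (Es j) ∈ L → Ends j
    ends-on-E {j} s∈ t∈ with ∈⇒nth {d = x} s∈ | ∈⇒nth {d = x} t∈
    ... | a , a< , s≡ | b , b< , t≡ with <-cmp a b
    ... | tri< a<b _ _ = record { left = a ; right = b ; left<right = a<b ; right<len = b< ; ends = inj₁ (sym s≡ , sym t≡) }
    ... | tri> _ _ b<a = record { left = b ; right = a ; left<right = b<a ; right<len = a< ; ends = inj₂ (sym t≡ , sym s≡) }
    ... | tri≈ _ refl _ = ⊥-elim (unique-++⇒disjoint [ start (Es j) ] (ear-unique j) (here refl)
                                    (∈-++⁺ʳ (inner (Es j)) (here (trans s≡ (sym t≡)))))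

  module _ (i : Fin ℓ) where
    open Ends (ends-on-E (proj₁ (proj₂ (nested i))) (proj₁ (proj₂ (proj₂ (nested i))))) public

  interval : Fin ℓ → List (Fin n)
  interval i = seg (left i) (suc (right i))

  interval-is-Interval : ∀ i → Interval Es e (F i) (interval i)
  interval-is-Interval i = (take (left i) L , drop (suc (right i)) L , seg-infix (<⇒≤ (m<n⇒m<1+n (left<right i))) (right<len i)) , oriented (ends i)
    where
      starts : StartsAt (interval i) (at (left i))
      starts = _ , seg-cons (m<n⇒m<1+n (left<right i))
      finishes : EndsAt (interval i) (at (right i))
      finishes = _ , seg-snoc (<⇒≤ (left<right i))
      oriented : (at (left i) ≡ start (Es (F i)) × at (right i) ≡ end (Es (F i)))
               ⊎ (at (left i) ≡ end (Es (F i)) × at (right i) ≡ start (Es (F i)))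
               → (StartsAt (interval i) (start (Es (F i))) × EndsAt (interval i) (end (Es (F i))))
               ⊎ (StartsAt (interval i) (end (Es (F i))) × EndsAt (interval i) (start (Es (F i))))
      oriented (inj₁ (l≡ , r≡)) = inj₁ (subst (StartsAt _) l≡ starts , subst (EndsAt _) r≡ finishes)
      oriented (inj₂ (l≡ , r≡)) = inj₂ (subst (StartsAt _) l≡ starts , subst (EndsAt _) r≡ finishes)

  interval-edge : ∀ i t → left i ≤ t → suc t ≤ right i → EdgeOf (interval i) (at t) (at (suc t))
  interval-edge i t l≤t t<r = inj₁ (consec-seg t l≤t (s≤s t<r))

  no-common-edge : ∀ {i i′} t → i ≢ i′ → left i ≤ t → suc t ≤ right i → left i′ ≤ t → suc t ≤ right i′ → ⊥
  no-common-edge {i} {i′} t i≢i′ l≤t t<r l′≤t t<r′ =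
    intervals-disjoint i i′ _ _ i≢i′ (interval-is-Interval i) (interval-is-Interval i′) (at t) (at (suc t))
      (interval-edge i t l≤t t<r) (interval-edge i′ t l′≤t t<r′)

  left-injective : ∀ {i i′} → left i ≡ left i′ → i ≡ i′
  left-injective {i} {i′} l≡ with i Fin.≟ i′
  ... | yes i≡i′ = i≡i′
  ... | no i≢i′ = ⊥-elim (no-common-edge (left i) i≢i′ ≤-refl (left<right i) (≤-reflexive (sym l≡))
                            (subst (λ t → suc t ≤ right i′) (sym l≡) (left<right i′)))

  right≤left : ∀ {i i′} → left i < left i′ → right i ≤ left i′
  right≤left {i} {i′} l<l′ with ≤-<-connex (right i) (left i′)
  ... | inj₁ r≤l′ = r≤l′
  ... | inj₂ l′<r = ⊥-elim (no-common-edge (left i′) (λ { refl → <-irrefl refl l<l′ }) (<⇒≤ l<l′) l′<r ≤-refl (left<right i′))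

  F-injective : ∀ {i i′} → F i ≡ F i′ → i ≡ i′
  F-injective {i} {i′} F≡ with i Fin.≟ i′
  ... | yes i≡i′ = i≡i′
  ... | no i≢i′ = ⊥-elim (intervals-disjoint i i′ _ _ i≢i′ (interval-is-Interval i)
                            (subst (λ j → Interval Es e j (interval i)) F≡ (interval-is-Interval i))
                            (at (left i)) (at (suc (left i))) edge edge)
    where edge = interval-edge i (left i) ≤-refl (left<right i)

  private
    P-segment : Segment P L
    P-segment = proj₁ P-cover

  start-of-P end-of-P : ℕ
  start-of-P = length (proj₁ P-segment)
  end-of-P = start-of-P + length P

  P≡seg : P ≡ seg start-of-P end-of-P
  P≡seg = infix⇒seg (proj₁ P-segment) P (proj₁ (proj₂ P-segment)) (proj₂ (proj₂ P-segment))

  end-of-P≤len : end-of-P ≤ length L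
  end-of-P≤len = subst (end-of-P ≤_) (sym length-L) (+-monoʳ-≤ start-of-P (m≤m+n (length P) _))
    where
      length-L : length L ≡ start-of-P + (length P + length (proj₁ (proj₂ P-segment)))
      length-L = trans (cong length (proj₂ (proj₂ P-segment))) (trans (length-++ (proj₁ P-segment)) (cong (start-of-P +_) (length-++ P)))

  on-P⇒in-range : ∀ {t} → t < length L → at t ∈ P → start-of-P ≤ t × t < end-of-P
  on-P⇒in-range t< at∈ with ∈-seg (m≤m+n start-of-P (length P)) (subst (_ ∈_) P≡seg at∈)
  ... | t′ , r≤t′ , t′<r , at≡ with at-injective t< (<-≤-trans t′<r end-of-P≤len) at≡
  ... | refl = r≤t′ , t′<r

  intervals-in-range : ∀ i → start-of-P ≤ left i × right i < end-of-P
  intervals-in-range i = proj₁ (on-P⇒in-range (<-trans (left<right i) (right<len i)) (⊆P (at (left i)) left∈))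
                       , proj₂ (on-P⇒in-range (right<len i) (⊆P (at (right i)) right∈))
    where
      ⊆P : ∀ v → v ∈ interval i → v ∈ P
      ⊆P = proj₁ (proj₁ (proj₂ P-cover) i (interval i) (interval-is-Interval i))
      left∈ : at (left i) ∈ interval i
      left∈ = subst (at (left i) ∈_) (sym (seg-cons (m<n⇒m<1+n (left<right i)))) (here refl)
      right∈ : at (right i) ∈ interval i
      right∈ = subst (at (right i) ∈_) (sym (seg-snoc (<⇒≤ (left<right i)))) (∈-++⁺ʳ _ (here refl))

  E-edge-on-P : ∀ {a b u v} → start-of-P ≤ a → a ≤ b → b ≤ end-of-P → Consec (seg a b) u v → Consec P u v
  E-edge-on-P r≤a a≤b b≤r c = subst (λ xs → Consec xs _ _) (sym P≡seg) (consec-seg-mono r≤a a≤b b≤r c)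

  w : Fin ℓ → Fin n
  w i = proj₁ (x-ear i)

  w-inner : ∀ i → w i ∈ inner (Es (F i))
  w-inner i = proj₁ (proj₂ (x-ear i))

  y : Fin ℓ → Fin n
  y i = proj₁ (proj₂ (proj₂ (proj₂ (x-ear i))))

  w~y : ∀ i → Adj G (w i) (y i)
  w~y i = proj₂ (proj₂ (proj₂ (proj₂ (proj₂ (x-ear i)))))

  x~y : ∀ i → Adj G x (y i)
  x~y i with proj₁ (proj₂ (proj₂ (proj₂ (proj₂ (x-ear i)))))
  ... | inj₂ adjacent = adjacent
  ... | inj₁ y≡x = ⊥-elim (proj₁ (proj₂ (proj₂ (x-ear i))) (inj₂ (Adj-sym G (subst (Adj G (w i)) y≡x (w~y i)))))

  y-in-X : ∀ i → IsX (y i)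
  y-in-X i = inj₂ (x~y i)

  x≢y : ∀ i → x ≢ y i
  x≢y i x≡y = Adj-irrefl G (subst (Adj G x) (sym x≡y) (x~y i))

  inner-avoids-X : ∀ {i v} → v ∈ inner (Es (F i)) → ¬ IsX v
  inner-avoids-X {i} v∈ = ear-avoids-X (F i) (inner⊆verts v∈)

  inner-disjoint : ∀ {i i′ v} → i ≢ i′ → v ∈ inner (Es (F i)) → v ∉ inner (Es (F i′))
  inner-disjoint {i} {i′} i≢i′ v∈ v∈′ with Fin.<-cmp (F i) (F i′)
  ... | tri< F<F′ _ _ = inner-not-earlier F<F′ v∈′ (inner⊆verts v∈)
  ... | tri≈ _ F≡F′ _ = i≢i′ (F-injective F≡F′)
  ... | tri> _ _ F′<F = inner-not-earlier F′<F v∈ (inner⊆verts v∈′)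

  ear-edges-disjoint : ∀ {i i′ u v} → i ≢ i′ → EdgeOf (verts (Es (F i))) u v → ¬ EdgeOf (verts (Es (F i′))) u v
  ear-edges-disjoint {i} {i′} i≢i′ uv∈ uv∈′ with Fin.<-cmp (F i) (F i′)
  ... | tri< F<F′ _ _ = edge-not-earlier F<F′ uv∈′ uv∈
  ... | tri≈ _ F≡F′ _ = i≢i′ (F-injective F≡F′)
  ... | tri> _ _ F′<F = edge-not-earlier F′<F uv∈ uv∈′

  -- y i has degree 2, and x, w i, w i′ would be three distinct neighbours.
  y-injective : ∀ {i i′} → i ≢ i′ → y i ≢ y i′
  y-injective {i} {i′} i≢i′ y≡ with deg2 (y i) (x~y i)
  ... | _ , _ , _ , _ , _ , only =
    no-three-in-pair (only x (Adj-sym G (x~y i))) (only (w i) (Adj-sym G (w~y i)))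
                     (only (w i′) (Adj-sym G (subst (Adj G (w i′)) (sym y≡) (w~y i′))))
                     (λ x≡w → inner-avoids-X (w-inner i) (subst IsX x≡w (inj₁ refl)))
                     (λ x≡w′ → inner-avoids-X (w-inner i′) (subst IsX x≡w′ (inj₁ refl)))
                     (λ w≡w′ → inner-disjoint i≢i′ (w-inner i) (subst (_∈ inner (Es (F i′))) (sym w≡w′) (w-inner i′)))

  record Halves (i : Fin ℓ) : Set where
    field
      toward-left toward-right : List (Fin n)
      inner↭ : inner (Es (F i)) ↭ w i ∷ toward-left ++ toward-right
      to-left : Linked (EdgeOf (verts (Es (F i)))) (w i ∷ toward-left ++ [ at (left i) ])
      to-right : Linked (EdgeOf (verts (Es (F i)))) (w i ∷ toward-right ++ [ at (right i) ])

  halves : ∀ i → Halves i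
  halves i with split-at (Es (F i)) (w-inner i) | ends i
  ... | A , B , ↭AB , to-start , to-end | inj₁ (l≡ , r≡) = record
    { toward-left = A ; toward-right = B ; inner↭ = ↭AB
    ; to-left = subst (λ a → Linked _ (w i ∷ A ++ [ a ])) (sym l≡) to-start
    ; to-right = subst (λ a → Linked _ (w i ∷ B ++ [ a ])) (sym r≡) to-end }
  ... | A , B , ↭AB , to-start , to-end | inj₂ (l≡ , r≡) = record
    { toward-left = B ; toward-right = A ; inner↭ = ↭.trans ↭AB (↭.prep (w i) (↭.++-comm A B))
    ; to-left = subst (λ a → Linked _ (w i ∷ B ++ [ a ])) (sym l≡) to-end
    ; to-right = subst (λ a → Linked _ (w i ∷ A ++ [ a ])) (sym r≡) to-start }

  open Triples left left-injective

  SameEdge : Fin n → Fin n → Fin n → Fin n → Set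
  SameEdge a b u v = (u ≡ a × v ≡ b) ⊎ (u ≡ b × v ≡ a)

  SameEdge-sym : ∀ {a b u v} → SameEdge a b u v → SameEdge a b v u
  SameEdge-sym (inj₁ (u≡a , v≡b)) = inj₂ (v≡b , u≡a)
  SameEdge-sym (inj₂ (u≡b , v≡a)) = inj₁ (v≡a , u≡b)

  Spoke : Fin ℓ → Fin n → Fin n → Set
  Spoke j u v = SameEdge x (y j) u v ⊎ SameEdge (y j) (w j) u v

  _∈ᵀ_ : Fin ℓ → Triple → Set
  j ∈ᵀ T = j ≡ first T ⊎ j ≡ second T ⊎ j ≡ third T

  line : Triple → List (Fin n)
  line T = seg (right (first T)) (suc (left (third T)))

  line-start≤end : ∀ T → right (first T) ≤ left (third T)
  line-start≤end T = right≤left (<-trans (first<second T) (second<third T))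

  line-end<len : ∀ T → left (third T) < length L
  line-end<len T = <-trans (left<right (third T)) (right<len (third T))

  ∈-line : ∀ {T v} → v ∈ line T → ∃ λ t → right (first T) ≤ t × t ≤ left (third T) × t < length L × v ≡ at t
  ∈-line {T} v∈ with ∈-seg (≤-trans (line-start≤end T) (n≤1+n _)) v∈
  ... | t , r≤t , t≤ , v≡ = t , r≤t , ≤-pred t≤ , ≤-trans t≤ (line-end<len T) , v≡

  line-edge-on-E : ∀ {T u v} → EdgeOf (line T) u v → EdgeOf L u v
  line-edge-on-E {T} = Sum.map on-E on-E
    where
      on-E : ∀ {a b} → Consec (line T) a b → Consec L a b
      on-E c = subst (λ xs → Consec xs _ _) (sym (seg-infix (≤-trans (line-start≤end T) (n≤1+n _)) (line-end<len T)))
                 (consec-++ʳ (take (right (first T)) L) (consec-++ˡ _ c))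

  Used : Triple → Fin n → Fin n → Set
  Used T u v = EdgeOf (line T) u v ⊎ ∃ λ j → j ∈ᵀ T × (EdgeOf (verts (Es (F j))) u v ⊎ Spoke j u v)

  Used-sym : ∀ {T u v} → Used T u v → Used T v u
  Used-sym (inj₁ uv) = inj₁ (swap uv)
  Used-sym (inj₂ (j , j∈ , inj₁ uv)) = inj₂ (j , j∈ , inj₁ (swap uv))
  Used-sym (inj₂ (j , j∈ , inj₂ spoke)) = inj₂ (j , j∈ , inj₂ (Sum.map SameEdge-sym SameEdge-sym spoke))

  Union : SubG n
  Union = UnionGraph G x Es F P

  Used⇒E : ∀ {T u v} → Used T u v → E Union u v
  Used⇒E {T} (inj₁ uv) = inj₂ (Sum.map on-P on-P uv)
    where
      on-P : ∀ {a b} → Consec (line T) a b → Consec P a b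
      on-P = E-edge-on-P (≤-trans (proj₁ (intervals-in-range (first T))) (<⇒≤ (left<right (first T))))
                         (≤-trans (line-start≤end T) (n≤1+n _))
                         (<-trans (left<right (third T)) (proj₂ (intervals-in-range (third T))))
  Used⇒E (inj₂ (j , _ , inj₁ uv)) = inj₁ (j , inj₁ uv)
  Used⇒E (inj₂ (j , _ , inj₂ spoke)) =
    inj₁ (j , inj₂ (w j , y j , w-inner j , (λ w≡x → inner-avoids-X (w-inner j) (subst IsX (sym w≡x) (inj₁ refl)))
                   , w~y j , Adj-sym G (x~y j) , shape spoke))
    where
      shape : ∀ {u v} → Spoke j u v → (u ≡ w j × v ≡ y j) ⊎ (u ≡ y j × v ≡ w j) ⊎ (u ≡ y j × v ≡ x) ⊎ (u ≡ x × v ≡ y j)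
      shape (inj₁ (inj₁ xy)) = inj₂ (inj₂ (inj₂ xy))
      shape (inj₁ (inj₂ yx)) = inj₂ (inj₂ (inj₁ yx))
      shape (inj₂ (inj₁ yw)) = inj₂ (inj₁ yw)
      shape (inj₂ (inj₂ wy)) = inj₁ wy

  module TripleK4 (T : Triple) where
    open Halves

    s₁ s₂ s₃ : Fin ℓ
    s₁ = first T
    s₂ = second T
    s₃ = third T

    s₁∈T : s₁ ∈ᵀ T
    s₁∈T = inj₁ refl
    s₂∈T : s₂ ∈ᵀ T
    s₂∈T = inj₂ (inj₁ refl)
    s₃∈T : s₃ ∈ᵀ T
    s₃∈T = inj₂ (inj₂ refl)

    q₁ p₂ q₂ p₃ : ℕ
    q₁ = right s₁
    p₂ = left s₂
    q₂ = right s₂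
    p₃ = left s₃

    q₁≤p₂ : q₁ ≤ p₂
    q₁≤p₂ = right≤left (first<second T)
    p₂<q₂ : p₂ < q₂
    p₂<q₂ = left<right s₂
    q₂≤p₃ : q₂ ≤ p₃
    q₂≤p₃ = right≤left (second<third T)

    S₁ S₅ S₂ : List (Fin n)
    S₁ = seg q₁ p₂
    S₅ = seg (suc p₂) q₂
    S₂ = seg (suc q₂) (suc p₃)

    A₁ B₁ A₂ B₂ A₃ B₃ : List (Fin n)
    A₁ = toward-left (halves s₁)
    B₁ = toward-right (halves s₁)
    A₂ = toward-left (halves s₂)
    B₂ = toward-right (halves s₂)
    A₃ = toward-left (halves s₃)
    B₃ = toward-right (halves s₃)

    -- Route k runs between the ends of pairs k: x–w₂, x–a, x–b, w₂–a, w₂–b, a–b with a = at p₂, b = at q₂.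
    branch′ : Fin 4 → Fin n
    branch′ 0F = x
    branch′ 1F = w s₂
    branch′ 2F = at p₂
    branch′ 3F = at q₂

    interior : Fin 6 → List (Fin n)
    interior 0F = [ y s₂ ]
    interior 1F = y s₁ ∷ w s₁ ∷ B₁ ++ S₁
    interior 2F = y s₃ ∷ w s₃ ∷ A₃ ++ reverse S₂
    interior 3F = A₂
    interior 4F = B₂
    interior 5F = S₅

    ear-used : ∀ {j xs} → j ∈ᵀ T → Linked (EdgeOf (verts (Es (F j)))) xs → Linked (Used T) xs
    ear-used j∈ = Linked.map (λ uv → inj₂ (_ , j∈ , inj₁ uv))

    spoke-x : ∀ {j} → j ∈ᵀ T → Used T x (y j)
    spoke-x j∈ = inj₂ (_ , j∈ , inj₂ (inj₁ (inj₁ (refl , refl))))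

    spoke-w : ∀ {j} → j ∈ᵀ T → Used T (y j) (w j)
    spoke-w j∈ = inj₂ (_ , j∈ , inj₂ (inj₂ (inj₁ (refl , refl))))

    line-used : ∀ {a b} → q₁ ≤ a → a ≤ b → b ≤ suc p₃ → Linked (Used T) (seg a b)
    line-used q₁≤a a≤b b≤ = linked-consec _ (λ c → inj₁ (inj₁ (consec-seg-mono q₁≤a a≤b b≤ c)))

    q₁≤q₂ : q₁ ≤ q₂
    q₁≤q₂ = ≤-trans q₁≤p₂ (<⇒≤ p₂<q₂)
    q₂≤suc-p₃ : q₂ ≤ suc p₃
    q₂≤suc-p₃ = ≤-trans q₂≤p₃ (n≤1+n p₃)

    up-to-p₂ : Linked (Used T) (w s₁ ∷ (B₁ ++ S₁) ++ [ at p₂ ])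
    up-to-p₂ = subst (Linked (Used T)) (cong (w s₁ ∷_) (sym (++-assoc B₁ S₁ [ at p₂ ])))
      (attach (w s₁ ∷ B₁) (trans (sym (seg-cons (s≤s q₁≤p₂))) (seg-snoc q₁≤p₂)) (ear-used s₁∈T (to-right (halves s₁)))
        (subst (Linked (Used T)) (seg-snoc q₁≤p₂)
          (line-used ≤-refl (≤-trans q₁≤p₂ (n≤1+n p₂)) (s≤s (≤-trans (<⇒≤ p₂<q₂) q₂≤p₃)))))

    down-to-q₂ : Linked (Used T) (w s₃ ∷ (A₃ ++ reverse S₂) ++ [ at q₂ ])
    down-to-q₂ = subst (Linked (Used T)) (cong (w s₃ ∷_) (sym (++-assoc A₃ (reverse S₂) [ at q₂ ])))
      (attach (w s₃ ∷ A₃) (trans from-p₃ to-q₂) (ear-used s₃∈T (to-left (halves s₃)))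
        (subst (Linked (Used T)) to-q₂ (linked-reverse (Used-sym {T}) (line-used q₁≤q₂ q₂≤suc-p₃ ≤-refl))))
      where
        from-p₃ : at p₃ ∷ reverse (seg q₂ p₃) ≡ reverse (seg q₂ (suc p₃))
        from-p₃ = trans (sym (reverse-++ (seg q₂ p₃) [ at p₃ ])) (cong reverse (sym (seg-snoc q₂≤p₃)))
        to-q₂ : reverse (seg q₂ (suc p₃)) ≡ reverse S₂ ++ [ at q₂ ]
        to-q₂ = trans (cong reverse (seg-cons (s≤s q₂≤p₃))) (unfold-reverse (at q₂) S₂)

    linked-route : ∀ r → Linked (Used T) (branch′ (proj₁ (pairs {n} r)) ∷ interior r ++ [ branch′ (proj₂ (pairs {n} r)) ])
    linked-route 0F = spoke-x s₂∈T ∷ spoke-w s₂∈T ∷ [-]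
    linked-route 1F = spoke-x s₁∈T ∷ spoke-w s₁∈T ∷ up-to-p₂
    linked-route 2F = spoke-x s₃∈T ∷ spoke-w s₃∈T ∷ down-to-q₂
    linked-route 3F = ear-used s₂∈T (to-left (halves s₂))
    linked-route 4F = ear-used s₂∈T (to-right (halves s₂))
    linked-route 5F = subst (Linked (Used T)) (trans (seg-snoc (<⇒≤ p₂<q₂)) (cong (_++ [ at q₂ ]) (seg-cons p₂<q₂)))
                        (line-used q₁≤p₂ (≤-trans (<⇒≤ p₂<q₂) (n≤1+n q₂)) (s≤s q₂≤p₃))

    s₁≢s₂ : s₁ ≢ s₂
    s₁≢s₂ s≡ = <-irrefl (cong left s≡) (first<second T)
    s₂≢s₃ : s₂ ≢ s₃
    s₂≢s₃ s≡ = <-irrefl (cong left s≡) (second<third T)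
    s₁≢s₃ : s₁ ≢ s₃
    s₁≢s₃ s≡ = <-irrefl (cong left s≡) (<-trans (first<second T) (second<third T))

    hub : List (Fin n)
    hub = x ∷ y s₁ ∷ y s₂ ∷ y s₃ ∷ []

    inners : List (Fin n)
    inners = inner (Es (F s₁)) ++ inner (Es (F s₂)) ++ inner (Es (F s₃))


    ∈-inners : ∀ {v} → v ∈ inners → v ∈ inner (Es (F s₁)) ⊎ v ∈ inner (Es (F s₂)) ⊎ v ∈ inner (Es (F s₃))
    ∈-inners v∈ with ∈-++⁻ (inner (Es (F s₁))) v∈
    ... | inj₁ v∈₁ = inj₁ v∈₁
    ... | inj₂ v∈₂₃ = inj₂ (∈-++⁻ (inner (Es (F s₂))) v∈₂₃)

    inners-avoid-X : ∀ {v} → v ∈ inners → ¬ IsX v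
    inners-avoid-X v∈ with ∈-inners v∈
    ... | inj₁ v∈₁ = inner-avoids-X v∈₁
    ... | inj₂ (inj₁ v∈₂) = inner-avoids-X v∈₂
    ... | inj₂ (inj₂ v∈₃) = inner-avoids-X v∈₃

    inners-off-E : ∀ {v} → v ∈ inners → v ∉ L
    inners-off-E v∈ with ∈-inners v∈
    ... | inj₁ v∈₁ = inner-off-E v∈₁
    ... | inj₂ (inj₁ v∈₂) = inner-off-E v∈₂
    ... | inj₂ (inj₂ v∈₃) = inner-off-E v∈₃

    line-on-E : ∀ {v} → v ∈ line T → v ∈ L
    line-on-E v∈ with ∈-line {T} v∈
    ... | t , _ , _ , t< , refl = nth-∈ t<

    inners-unique : Unique inners
    inners-unique =
      unique-++-separated (inner-unique _)
        (unique-++-separated (inner-unique _) (inner-unique _) id (λ v∈₃ v∈₂ → inner-disjoint s₂≢s₃ v∈₂ v∈₃))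
        id (λ v∈ v∈₁ → [ (λ v∈₂ → inner-disjoint s₁≢s₂ v∈₁ v∈₂) , (λ v∈₃ → inner-disjoint s₁≢s₃ v∈₁ v∈₃) ]′
                          (∈-++⁻ (inner (Es (F s₂))) v∈))

    all-unique : Unique (hub ++ inners ++ line T)
    all-unique =
      unique-++-separated {Q = IsX}
        ((x≢y s₁ ∷ x≢y s₂ ∷ x≢y s₃ ∷ []) ∷ (y-injective s₁≢s₂ ∷ y-injective s₁≢s₃ ∷ []) ∷ (y-injective s₂≢s₃ ∷ []) ∷ [] ∷ [])
        (unique-++-separated {Q = _∉ L} inners-unique (seg-unique (ear-unique e) (≤-trans (line-start≤end T) (n≤1+n _)) (line-end<len T))
           inners-off-E (λ v∈ v∉ → v∉ (line-on-E v∈)))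
        (All.lookup (inj₁ refl ∷ y-in-X s₁ ∷ y-in-X s₂ ∷ y-in-X s₃ ∷ []))
        (λ v∈ → [ inners-avoid-X , (λ v∈line → case ∈-line {T} v∈line of λ { (t , _ , _ , t< , refl) → E-avoids-X t< }) ]′ (∈-++⁻ inners v∈))

    line-split : line T ≡ S₁ ++ at p₂ ∷ S₅ ++ at q₂ ∷ S₂
    line-split = begin
      seg q₁ (suc p₃)                              ≡⟨ sym (seg-++ q₁≤p₂ p₂≤suc-p₃) ⟩
      S₁ ++ seg p₂ (suc p₃)                        ≡⟨ cong (S₁ ++_) (seg-cons (s≤s (≤-trans (<⇒≤ p₂<q₂) q₂≤p₃))) ⟩
      S₁ ++ at p₂ ∷ seg (suc p₂) (suc p₃)          ≡⟨ cong (λ z → S₁ ++ at p₂ ∷ z) (sym (seg-++ p₂<q₂ q₂≤suc-p₃)) ⟩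
      S₁ ++ at p₂ ∷ S₅ ++ seg q₂ (suc p₃)          ≡⟨ cong (λ z → S₁ ++ at p₂ ∷ S₅ ++ z) (seg-cons (s≤s q₂≤p₃)) ⟩
      S₁ ++ at p₂ ∷ S₅ ++ at q₂ ∷ S₂               ∎
      where
        open ≡-Reasoning
        p₂≤suc-p₃ : p₂ ≤ suc p₃
        p₂≤suc-p₃ = ≤-trans (<⇒≤ p₂<q₂) q₂≤suc-p₃

    -- Up to the halves A₁ and B₃, which no route uses, the routes rearrange hub, ear interiors and the line of T.
    rearranged : hub ++ inners ++ line T
               ↭ (x ∷ w s₂ ∷ at p₂ ∷ at q₂ ∷ interior 0F ++ interior 1F ++ interior 2F ++ interior 3F ++ interior 4F ++ interior 5F)
                 ++ A₁ ++ B₃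
    rearranged = ↭.trans (↭.++⁺ˡ hub (↭.++⁺ inners↭ line↭)) (solve 18
      (λ X Y₁ Y₂ Y₃ W₁ W₂ W₃ a₁ b₁ a₂ b₂ a₃ b₃ s₁ P₂ s₅ Q₂ r₂ →
         X ⊕ (Y₁ ⊕ (Y₂ ⊕ (Y₃ ⊕ (((W₁ ⊕ (a₁ ⊕ b₁)) ⊕ ((W₂ ⊕ (a₂ ⊕ b₂)) ⊕ (W₃ ⊕ (a₃ ⊕ b₃)))) ⊕ (s₁ ⊕ (P₂ ⊕ (s₅ ⊕ (Q₂ ⊕ r₂))))))))
       ⊜ (X ⊕ (W₂ ⊕ (P₂ ⊕ (Q₂ ⊕ (Y₂ ⊕ ((Y₁ ⊕ (W₁ ⊕ (b₁ ⊕ s₁))) ⊕ ((Y₃ ⊕ (W₃ ⊕ (a₃ ⊕ r₂))) ⊕ (a₂ ⊕ (b₂ ⊕ s₅)))))))))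
         ⊕ (a₁ ⊕ b₃))
      ↭-refl [ x ] [ y s₁ ] [ y s₂ ] [ y s₃ ] [ w s₁ ] [ w s₂ ] [ w s₃ ] A₁ B₁ A₂ B₂ A₃ B₃ S₁ [ at p₂ ] S₅ [ at q₂ ] (reverse S₂))
      where
        open import Algebra.Solver.CommutativeMonoid (↭.++-commutativeMonoid {A = Fin n}) using (solve; _⊜_; _⊕_)
        inners↭ : inners ↭ (w s₁ ∷ A₁ ++ B₁) ++ (w s₂ ∷ A₂ ++ B₂) ++ (w s₃ ∷ A₃ ++ B₃)
        inners↭ = ↭.++⁺ (inner↭ (halves s₁)) (↭.++⁺ (inner↭ (halves s₂)) (inner↭ (halves s₃)))
        line↭ : line T ↭ S₁ ++ at p₂ ∷ S₅ ++ at q₂ ∷ reverse S₂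
        line↭ = subst (_↭ S₁ ++ at p₂ ∷ S₅ ++ at q₂ ∷ reverse S₂) (sym line-split)
                  (↭.++⁺ˡ S₁ (↭.prep (at p₂) (↭.++⁺ˡ S₅ (↭.prep (at q₂) (↭-sym (↭.↭-reverse S₂))))))

    k4 : Σ (K4Subdivision Union) λ K → ∀ u v → KEdge K u v → Used T u v
    k4 = k4-from-paths (Used-sym {T}) (Used⇒E {T}) (λ {_} {v} uv → v , uv) branch′ interior
           (unique-++⁻ˡ (unique-resp-↭ rearranged all-unique)) linked-route

  ∈ᵀ-bounds : ∀ {j T} → j ∈ᵀ T → left (first T) ≤ left j × left j ≤ left (third T)
  ∈ᵀ-bounds {T = T} (inj₁ refl) = ≤-refl , <⇒≤ (<-trans (first<second T) (second<third T))
  ∈ᵀ-bounds {T = T} (inj₂ (inj₁ refl)) = <⇒≤ (first<second T) , <⇒≤ (second<third T)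
  ∈ᵀ-bounds {T = T} (inj₂ (inj₂ refl)) = <⇒≤ (<-trans (first<second T) (second<third T)) , ≤-refl

  ≺⇒distinct : ∀ {T T′ j j′} → T ≺ T′ → j ∈ᵀ T → j′ ∈ᵀ T′ → j ≢ j′
  ≺⇒distinct {T} {T′} T≺T′ j∈ j′∈ refl = <-irrefl refl (≤-<-trans (proj₂ (∈ᵀ-bounds {T = T} j∈)) (<-≤-trans T≺T′ (proj₁ (∈ᵀ-bounds {T = T′} j′∈))))

  spoke-shape : ∀ {j u v} → Spoke j u v → (u ≡ y j × (v ≡ x ⊎ v ≡ w j)) ⊎ (v ≡ y j × (u ≡ x ⊎ u ≡ w j))
  spoke-shape (inj₁ (inj₁ (u≡x , v≡y))) = inj₂ (v≡y , inj₁ u≡x)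
  spoke-shape (inj₁ (inj₂ (u≡y , v≡x))) = inj₁ (u≡y , inj₁ v≡x)
  spoke-shape (inj₂ (inj₁ (u≡y , v≡w))) = inj₁ (u≡y , inj₂ v≡w)
  spoke-shape (inj₂ (inj₂ (u≡w , v≡y))) = inj₂ (v≡y , inj₂ u≡w)

  spoke-meets-X : ∀ {j u v} → Spoke j u v → IsX u ⊎ IsX v
  spoke-meets-X {j} spoke with spoke-shape spoke
  ... | inj₁ (refl , _) = inj₁ (y-in-X j)
  ... | inj₂ (refl , _) = inj₂ (y-in-X j)

  y-not-rim : ∀ {i j z} → z ≡ x ⊎ z ≡ w j → y i ≢ z
  y-not-rim {i} (inj₁ refl) y≡x = x≢y i (sym y≡x)
  y-not-rim {i} {j} (inj₂ refl) y≡w = inner-avoids-X (w-inner j) (subst IsX y≡w (y-in-X i))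

  spokes-disjoint : ∀ {j j′ u v} → j ≢ j′ → Spoke j u v → ¬ Spoke j′ u v
  spokes-disjoint j≢j′ spoke spoke′ with spoke-shape spoke | spoke-shape spoke′
  ... | inj₁ (refl , _) | inj₁ (y≡ , _) = y-injective j≢j′ y≡
  ... | inj₂ (refl , _) | inj₂ (y≡ , _) = y-injective j≢j′ y≡
  ... | inj₁ (refl , rim) | inj₂ (refl , _) = y-not-rim rim refl
  ... | inj₂ (refl , rim) | inj₁ (refl , _) = y-not-rim rim refl

  edge-avoids-X : ∀ {xs u v} → (∀ {z} → z ∈ xs → ¬ IsX z) → EdgeOf xs u v → IsX u ⊎ IsX v → ⊥
  edge-avoids-X avoids uv (inj₁ u∈X) = avoids (proj₁ (edgeOf-∈ uv)) u∈X
  edge-avoids-X avoids uv (inj₂ v∈X) = avoids (proj₂ (edgeOf-∈ uv)) v∈X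

  line-avoids-X : ∀ {T z} → z ∈ line T → ¬ IsX z
  line-avoids-X {T} z∈ with ∈-line {T} z∈
  ... | _ , _ , _ , t< , refl = E-avoids-X t<

  used-disjoint : ∀ {T T′ u v} → T ≺ T′ → Used T u v → Used T′ u v → ⊥
  used-disjoint {T} {T′} T≺T′ (inj₁ uv) (inj₁ uv′) with ∈-line {T} (proj₁ (edgeOf-∈ uv)) | ∈-line {T′} (proj₁ (edgeOf-∈ uv′))
  ... | t , _ , t≤ , t< , refl | t′ , r′≤t′ , _ , t′< , at≡ with at-injective t< t′< at≡
  ... | refl = <-irrefl refl (≤-<-trans t≤ (<-≤-trans T≺T′ (≤-trans (<⇒≤ (left<right (first T′))) r′≤t′)))
  used-disjoint {T} _ (inj₁ uv) (inj₂ (j , _ , inj₁ uv′)) = edge-not-earlier (e<F j) uv′ (line-edge-on-E {T} uv)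
  used-disjoint {T} _ (inj₁ uv) (inj₂ (j , _ , inj₂ spoke)) = edge-avoids-X (line-avoids-X {T}) uv (spoke-meets-X {j} spoke)
  used-disjoint {T′ = T′} _ (inj₂ (j , _ , inj₁ uv)) (inj₁ uv′) = edge-not-earlier (e<F j) uv (line-edge-on-E {T′} uv′)
  used-disjoint {T′ = T′} _ (inj₂ (j , _ , inj₂ spoke)) (inj₁ uv′) = edge-avoids-X (line-avoids-X {T′}) uv′ (spoke-meets-X {j} spoke)
  used-disjoint {T} {T′} T≺T′ (inj₂ (j , j∈ , inj₁ uv)) (inj₂ (j′ , j′∈ , inj₁ uv′)) = ear-edges-disjoint (≺⇒distinct {T} {T′} T≺T′ j∈ j′∈) uv uv′
  used-disjoint _ (inj₂ (j , _ , inj₁ uv)) (inj₂ (j′ , _ , inj₂ spoke)) = edge-avoids-X (ear-avoids-X (F j)) uv (spoke-meets-X {j′} spoke)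
  used-disjoint _ (inj₂ (j , _ , inj₂ spoke)) (inj₂ (j′ , _ , inj₁ uv′)) = edge-avoids-X (ear-avoids-X (F j′)) uv′ (spoke-meets-X {j} spoke)
  used-disjoint {T} {T′} T≺T′ (inj₂ (j , j∈ , inj₂ spoke)) (inj₂ (j′ , j′∈ , inj₂ spoke′)) = spokes-disjoint (≺⇒distinct {T} {T′} T≺T′ j∈ j′∈) spoke spoke′

  edge-disjoint-K4s : Σ (Fin (ℓ / 3) → K4Subdivision Union) λ Ks → ∀ a b → a ≢ b → K4EdgeDisjoint (Ks a) (Ks b)
  edge-disjoint-K4s = proj₁ ∘ K , disjoint
    where
      K : ∀ a → Σ (K4Subdivision Union) λ K → ∀ u v → KEdge K u v → Used (proj₁ triples a) u v
      K a = TripleK4.k4 (proj₁ triples a)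
      disjoint : ∀ a b → a ≢ b → K4EdgeDisjoint (proj₁ (K a)) (proj₁ (K b))
      disjoint a b a≢b u v uv∈a uv∈b with proj₂ triples a b a≢b
      ... | inj₁ a≺b = used-disjoint {proj₁ triples a} {proj₁ triples b} a≺b (proj₂ (K a) u v uv∈a) (proj₂ (K b) u v uv∈b)
      ... | inj₂ b≺a = used-disjoint {proj₁ triples b} {proj₁ triples a} b≺a (proj₂ (K b) u v uv∈b) (proj₂ (K a) u v uv∈a)

lemma22 : ∀ {n : ℕ} (G : Graph n) (x : Fin n)
    → (∀ y → Adj G x y → Degree2 G y)
    → TwoConnected (minusX G x (whole G))
    → SeriesParallel (minusX G x (whole G))
    → K4Subdivision (whole G)
    → (H : SubG n) → IsSubgraph G H → SeriesParallel (minusX G x H)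
    → ∀ {k : ℕ} (Es : Fin k → NPath n) → NED (minusX G x H) Es
    → (e : Fin k) (ℓ : ℕ) (F : Fin ℓ → Fin k)
    → (∀ i → XEar G x Es (F i))
    → (∀ i → NestedIn Es (F i) e)
    → (∀ i i' I I' → i ≢ i' → Interval Es e (F i) I → Interval Es e (F i') I' → EdgeDisjoint I I')
    → (P : List (Fin n)) → MinimalCover Es e F P
    → Σ (Fin (ℓ / 3) → K4Subdivision (UnionGraph G x Es F P))
        (λ Ks → ∀ a b → a ≢ b → K4EdgeDisjoint (Ks a) (Ks b))
lemma22 G x deg2 _ _ _ H _ _ Es ned e ℓ F x-ear nested disjoint P cover =
  NestedXEars.edge-disjoint-K4s G x deg2 H Es (proj₁ ned) e ℓ F x-ear nested disjoint P cover
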